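{- Let $\tau$ be a finite relational vocabulary, let $\mathfrak A=((A,n),(R^{\mathfrak A})_{R\in\tau})$ be a $\tau$-multistructure, and let $(X,m)$ be a multiteam over $\mathfrak A$ such that $n(a)=1$ for all $a\in A$ and $m(s)=1$ for all $s\in X$. Let $\mathfrak B:=(A,(R^{\mathfrak A})_{R\in\tau})$ be the ordinary $\tau$-structure. Then for every first-order formula $\varphi$ (in negation normal form) it holds that $\mathfrak A\models_{(X,m)}\varphi$ under lax multiteam semantics if and only if $\mathfrak B\models_X\varphi$ under lax team semantics.
   Context: Multisets: a multiset is a pair $(A,m)$ with $A$ a set and $m:A\to\mathbb N$ (multiplicity $0$ allowed); all multisets here are finite. Its canonical set representative is $\{(a,i): a\in A,\ 0<i\le m(a)\}$. We write $(A,m)\subseteq(B,n)$ iff the canonical representative of $(A,m)$ is a subset of that of $(B,n)$; $|(A,m)|=\sum_{a\in A}m(a)$; the disjoint union $(A,m)\uplus(B,n)$ is $(A\cup B,k)$ where $k$ adds the multiplicities (an element missing from one multiset counts with multiplicity $0$ there). An assignment is a function $s:D\to A$ with $D$ a finite set of variables; $s(a/x)$ is the assignment on $D\cup\{x\}$ sending $x$ to $a$ and agreeing with $s$ elsewhere. A team is a finite set of assignments with a common domain and codomain; a multiteam is a multiset $(X,m)$ with $X$ a team. A $\tau$-multistructure is $\mathfrak A=((A,n),(R^{\mathfrak A})_{R\in\tau})$ with $(A,n)$ a finite multiset and each $R^{\mathfrak A}$ an $\mathrm{ar}(R)$-ary relation on $\{a\in A:n(a)\ge 1\}$; a multiteam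 over $\mathfrak A$ is one with codomain $A$. Modified multiteams: $(X,m)[(A,n)/x]:=\biguplus_{s\in X}\biguplus_{a\in A}\{(s(a/x),\,m(s)\cdot n(a))\}$. $\mathcal P^+((A,n))$ is the set of submultisets $(C,l)\subseteq(A,n)$ with $C\ne\emptyset$ and $l(c)\ge1$ for all $c\in C$. For a function $F$ from the canonical representative of $(X,m)$ to $\mathcal P^+((A,n))$, $(X,m)[F/x]:=\biguplus_{s\in X}\biguplus_{1\le i\le m(s)}\{(s(b/x),l(b)) : (B,l)=F((s,i)),\ b\in B\}$. First-order formulas: $\varphi::= x=y\mid x\neq y\mid R(\vec x)\mid\neg R(\vec x)\mid\varphi\wedge\varphi\mid\varphi\vee\varphi\mid\exists x\varphi\mid\forall x\varphi$. Lax multiteam semantics (for $\mathfrak A$ with domain $(A,n)$): an atom or negated atom holds in $(X,m)$ iff every $s\in X$ with $m(s)\ge1$ satisfies it in the usual sense; $\wedge$ is interpreted classically; $\mathfrak A\models_{(X,m)}\psi\vee\theta$ iff there are $(Y,k),(Z,l)\subseteq(X,m)$ with $(X,m)\subseteq(Y,k)\uplus(Z,l)$, $\mathfrak A\models_{(Y,k)}\psi$ and $\mathfrak A\models_{(Z,l)}\theta$; $\mathfrak A\models_{(X,m)}\forall x\psi$ iff $\mathfrak A\models_{(X,m)[(A,n)/x]}\psi$; $\mathfrak A\models_{(X,m)}\exists x\psi$ iff $\mathfrak A\models_{(X,m)[F/x]}\psi$ for some $F$ from the canonical representative of $(X,m)$ to $\mathcal P^+((A,n))$. Lax team semantics (for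 an ordinary structure $\mathfrak B$ with domain $B$ and a team $X$ with codomain $B$): an atom or negated atom holds iff every $s\in X$ satisfies it; $\wedge$ classical; $\mathfrak B\models_X\psi\vee\theta$ iff $\mathfrak B\models_Y\psi$ and $\mathfrak B\models_Z\theta$ for some $Y,Z\subseteq X$ with $Y\cup Z=X$; $\mathfrak B\models_X\forall x\psi$ iff $\mathfrak B\models_{\{s(a/x):s\in X,a\in B\}}\psi$; $\mathfrak B\models_X\exists x\psi$ iff $\mathfrak B\models_{\{s(a/x):s\in X,a\in F(s)\}}\psi$ for some $F:X\to\mathcal P(B)\setminus\{\emptyset\}$. -}

module Defs where

open import Data.Nat using (ℕ; zero; suc; _+_; _*_; _≤_)
open import Data.Fin using (Fin)
import Data.Fin as Fin
open import Data.Bool using (Bool; _∧_; if_then_else_; T)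
open import Data.Maybe using (Maybe; just; nothing)
import Data.Maybe.Properties as MaybeP
open import Data.Vec using (Vec; lookup; _[_]≔_)
import Data.Vec as Vec
import Data.Vec.Properties as VecP
open import Data.List using (List; []; _∷_; foldr; concatMap; map; allFin; applyUpTo)
open import Data.Bool.ListAction using (any)
open import Data.Product using (Σ; ∃; ∃₂; _×_; _,_)
open import Data.Sum using (_⊎_)
open import Relation.Binary.PropositionalEquality using (_≡_; _≢_)
open import Relation.Binary.Definitions using (DecidableEquality)
open import Relation.Nullary using (¬_)
open import Relation.Nullary.Decidable using (⌊_⌋)

record Vocabulary : Set where
  field
    size  : ℕ
    arity : Fin size → ℕ
open Vocabulary public

-- Finite multisets over a (finite) type T, given by their multiplicity
-- function (elements of multiplicity 0 are allowed and harmless).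

MSet : Set → Set
MSet T = T → ℕ

-- membership of (t , i) in the canonical set representative
_∈ᶜ_ : {T : Set} → T × ℕ → MSet T → Set
(t , i) ∈ᶜ M = (1 ≤ i) × (i ≤ M t)

_⊆ᴹ_ : {T : Set} → MSet T → MSet T → Set
M ⊆ᴹ M' = ∀ p → p ∈ᶜ M → p ∈ᶜ M'

_⊎ᴹ_ : {T : Set} → MSet T → MSet T → MSet T
(M ⊎ᴹ M') t = M t + M' t

∅ᴹ : {T : Set} → MSet T
∅ᴹ _ = 0

⨄ : {I T : Set} → List I → (I → MSet T) → MSet T
⨄ is f = foldr (λ i acc → f i ⊎ᴹ acc) ∅ᴹ is

single : {T : Set} → DecidableEquality T → T → ℕ → MSet T
single _≟_ t k u = if ⌊ u ≟ t ⌋ then k else 0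

Rel : Vocabulary → ℕ → Set₁
Rel τ N = (R : Fin (size τ)) → Vec (Fin N) (arity τ R) → Set

record MultiStructure (τ : Vocabulary) (N : ℕ) : Set₁ where
  field
    mult   : MSet (Fin N)
    rel    : Rel τ N
    rel-wf : ∀ R as → rel R as → ∀ i → 1 ≤ mult (lookup as i)
open MultiStructure public

record Structure (τ : Vocabulary) (N : ℕ) : Set₁ where
  field
    srel : Rel τ N
open Structure public

underlying : {τ : Vocabulary} {N : ℕ} → MultiStructure τ N → Structure τ N
underlying 𝔄 = record { srel = rel 𝔄 }

-- Assignments: variables are Fin k; an assignment with domain D ⊆ Fin k
-- and codomain Fin N is a vector with `just a` exactly on D.

Asg : ℕ → ℕ → Set
Asg N k = Vec (Maybe (Fin N)) k

_≟A_ : {N k : ℕ} → DecidableEquality (Asg N k)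
_≟A_ = VecP.≡-dec (MaybeP.≡-dec Fin._≟_)

upd : {N k : ℕ} → Asg N k → Fin k → Fin N → Asg N k
upd s x a = s [ x ]≔ just a

-- enumeration of all assignments (each exactly once)
allMaybeFin : (N : ℕ) → List (Maybe (Fin N))
allMaybeFin N = nothing ∷ map just (allFin N)

allAsg : (N k : ℕ) → List (Asg N k)
allAsg N zero    = Vec.[] ∷ []
allAsg N (suc k) = concatMap (λ v → map (λ o → o Vec.∷ v) (allMaybeFin N)) (allAsg N k)

data Formula (τ : Vocabulary) (k : ℕ) : Set where
  eq neq   : Fin k → Fin k → Formula τ k
  rl nrl   : (R : Fin (size τ)) → Vec (Fin k) (arity τ R) → Formula τ k
  _∧ᶠ_ _∨ᶠ_ : Formula τ k → Formula τ k → Formula τ k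
  exᶠ allᶠ  : Fin k → Formula τ k → Formula τ k

-- Satisfaction of literals by a single assignment (usual sense; a
-- literal mentioning a variable outside dom s is not satisfied).

Val : {N k m : ℕ} → Asg N k → Vec (Fin k) m → Vec (Fin N) m → Set
Val s xs as = Vec.map (lookup s) xs ≡ Vec.map just as

eqSat : {N k : ℕ} → Asg N k → Fin k → Fin k → Set
eqSat s x y = ∃ λ a → lookup s x ≡ just a × lookup s y ≡ just a

neqSat : {N k : ℕ} → Asg N k → Fin k → Fin k → Set
neqSat s x y = ∃₂ λ a b → lookup s x ≡ just a × lookup s y ≡ just b × a ≢ b

relSat : {τ : Vocabulary} {N k : ℕ} → Rel τ N → Asg N k →
         (R : Fin (size τ)) → Vec (Fin k) (arity τ R) → Set
relSat ρ s R xs = ∃ λ as → Val s xs as × ρ R as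

nrelSat : {τ : Vocabulary} {N k : ℕ} → Rel τ N → Asg N k →
          (R : Fin (size τ)) → Vec (Fin k) (arity τ R) → Set
nrelSat ρ s R xs = ∃ λ as → Val s xs as × ¬ ρ R as

MTeam : ℕ → ℕ → Set
MTeam N k = MSet (Asg N k)

_[_/_]ᴹ : {N k : ℕ} → MTeam N k → MSet (Fin N) → Fin k → MTeam N k
_[_/_]ᴹ {N} {k} M A x =
  ⨄ (allAsg N k) λ s → ⨄ (allFin N) λ a → single _≟A_ (upd s x a) (M s * A a)

InP⁺ : {N : ℕ} → MSet (Fin N) → MSet (Fin N) → Set
InP⁺ A l = (l ⊆ᴹ A) × ∃ λ c → 1 ≤ l c

-- (X,m)[F/x];  F (s , i) is given as F s i (only relevant on the
-- canonical representative, i.e. for 1 ≤ i ≤ m s)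
_[_/_]ᶠ : {N k : ℕ} → MTeam N k → (Asg N k → ℕ → MSet (Fin N)) → Fin k → MTeam N k
_[_/_]ᶠ {N} {k} M F x =
  ⨄ (allAsg N k) λ s → ⨄ (applyUpTo suc (M s)) λ i →
    ⨄ (allFin N) λ b → single _≟A_ (upd s x b) (F s i b)

MSat : {τ : Vocabulary} {N k : ℕ} → MultiStructure τ N → MTeam N k → Formula τ k → Set
MSat 𝔄 M (eq x y)    = ∀ s → 1 ≤ M s → eqSat s x y
MSat 𝔄 M (neq x y)   = ∀ s → 1 ≤ M s → neqSat s x y
MSat 𝔄 M (rl R xs)   = ∀ s → 1 ≤ M s → relSat (rel 𝔄) s R xs
MSat 𝔄 M (nrl R xs)  = ∀ s → 1 ≤ M s → nrelSat (rel 𝔄) s R xs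
MSat 𝔄 M (φ ∧ᶠ ψ)    = MSat 𝔄 M φ × MSat 𝔄 M ψ
MSat 𝔄 M (φ ∨ᶠ ψ)    = ∃₂ λ Y Z → (Y ⊆ᴹ M) × (Z ⊆ᴹ M) × (M ⊆ᴹ (Y ⊎ᴹ Z))
                                 × MSat 𝔄 Y φ × MSat 𝔄 Z ψ
MSat 𝔄 M (allᶠ x φ)  = MSat 𝔄 (M [ mult 𝔄 / x ]ᴹ) φ
MSat 𝔄 M (exᶠ x φ)   = ∃ λ F → (∀ s i → (s , i) ∈ᶜ M → InP⁺ (mult 𝔄) (F s i))
                                × MSat 𝔄 (M [ F / x ]ᶠ) φ

-- Teams (finite sets of assignments, as decidable subsets) and lax team
-- semantics.

Team : ℕ → ℕ → Set
Team N k = Asg N k → Bool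

CommonDomain : {N k : ℕ} → Team N k → Set
CommonDomain X = ∀ s t → T (X s) → T (X t) → ∀ i → lookup s i ≡ nothing → lookup t i ≡ nothing

_[all/_]ᵀ : {N k : ℕ} → Team N k → Fin k → Team N k
_[all/_]ᵀ {N} {k} X x t =
  any (λ s → X s ∧ any (λ a → ⌊ t ≟A upd s x a ⌋) (allFin N)) (allAsg N k)

_[_/_]ᵀ : {N k : ℕ} → Team N k → (Asg N k → Fin N → Bool) → Fin k → Team N k
_[_/_]ᵀ {N} {k} X F x t =
  any (λ s → X s ∧ any (λ a → F s a ∧ ⌊ t ≟A upd s x a ⌋) (allFin N)) (allAsg N k)

TSat : {τ : Vocabulary} {N k : ℕ} → Structure τ N → Team N k → Formula τ k → Set
TSat 𝔅 X (eq x y)   = ∀ s → T (X s) → eqSat s x y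
TSat 𝔅 X (neq x y)  = ∀ s → T (X s) → neqSat s x y
TSat 𝔅 X (rl R xs)  = ∀ s → T (X s) → relSat (srel 𝔅) s R xs
TSat 𝔅 X (nrl R xs) = ∀ s → T (X s) → nrelSat (srel 𝔅) s R xs
TSat 𝔅 X (φ ∧ᶠ ψ)   = TSat 𝔅 X φ × TSat 𝔅 X ψ
TSat 𝔅 X (φ ∨ᶠ ψ)   = ∃₂ λ Y Z → (∀ s → T (Y s) → T (X s)) × (∀ s → T (Z s) → T (X s))
                                × (∀ s → T (X s) → T (Y s) ⊎ T (Z s))
                                × TSat 𝔅 Y φ × TSat 𝔅 Z ψ
TSat 𝔅 X (allᶠ x φ) = TSat 𝔅 (X [all/ x ]ᵀ) φ
TSat 𝔅 X (exᶠ x φ)  = ∃ λ F → (∀ s → T (X s) → ∃ λ a → T (F s a))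
                              × TSat 𝔅 (X [ F / x ]ᵀ) φ

module Submission where

-- First-order formulas are flat in lax semantics: a team
-- satisfies φ exactly when every assignment in it satisfies φ in the
-- ordinary Tarskian sense (Sat).
--
-- They rest on descriptions of the supports of
-- the modified (multi)teams, and, for the right-to-left directions, on
-- guarded choices turning a pointwise disjunction into a splitting of the
-- team and pointwise witnesses into a choice function.  Under the
-- hypotheses of proposition2 the support of m is exactly X (same-support),
-- so the two flatness results compose.

open import Defs
open import Data.Nat using (ℕ; zero; suc; _+_; _*_; _≤_; z≤n; s≤s)
open import Data.Nat.Properties using (≤-refl; ≤-trans; m≤m+n; m≤n+m; *-mono-≤; *-zeroʳ)
open import Data.Fin using (Fin)
import Data.Fin as Fin
open import Data.Bool using (Bool; true; false; T; _∧_)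
open import Data.Bool.Properties using (T-∧)
open import Data.Bool.ListAction using (any)
open import Data.Product using (∃; ∃₂; _×_; _,_; proj₁; proj₂)
open import Data.Sum using (_⊎_; inj₁; inj₂)
open import Data.Unit using (tt)
open import Data.Maybe using (Maybe; just; nothing)
open import Data.List using (List; []; _∷_; map; allFin; applyUpTo)
open import Data.List.Membership.Propositional using (_∈_; find; lose)
open import Data.List.Membership.Propositional.Properties
  using (∈-map⁺; ∈-concatMap⁺; ∈-allFin; ∈-applyUpTo⁺)
open import Data.List.Relation.Unary.Any using (Any; here; there; satisfied)
open import Data.List.Relation.Unary.Any.Properties using (any⁺; any⁻)
open import Data.Vec using (_∷_; [])
open import Relation.Binary.Definitions using (DecidableEquality)
open import Relation.Binary.PropositionalEquality using (_≡_; refl; sym; subst)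
open import Relation.Nullary using (contradiction)
open import Relation.Nullary.Decidable using (⌊_⌋; yes; no; toWitness; fromWitness)
open import Function.Base using (_∘_)
open import Function.Bundles using (_⇔_; mk⇔; Equivalence)
import Function.Properties.Equivalence as ⇔

module _ {τ : Vocabulary} {N k : ℕ} (ρ : Rel τ N) where
  Sat : Asg N k → Formula τ k → Set
  Sat s (eq x y)   = eqSat s x y
  Sat s (neq x y)  = neqSat s x y
  Sat s (rl R xs)  = relSat ρ s R xs
  Sat s (nrl R xs) = nrelSat ρ s R xs
  Sat s (φ ∧ᶠ ψ)   = Sat s φ × Sat s ψ
  Sat s (φ ∨ᶠ ψ)   = Sat s φ ⊎ Sat s ψ
  Sat s (allᶠ x φ) = ∀ a → Sat (upd s x a) φ
  Sat s (exᶠ x φ)  = ∃ λ a → Sat (upd s x a) φ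

allAsg-complete : ∀ N k (s : Asg N k) → s ∈ allAsg N k
allAsg-complete N zero    []      = here refl
allAsg-complete N (suc k) (o ∷ v) =
  ∈-concatMap⁺ _ (lose (allAsg-complete N k v) (entry o))
  where
  entry : (o : Maybe (Fin N)) → o ∷ v ∈ map (_∷ v) (allMaybeFin N)
  entry nothing  = here refl
  entry (just a) = there (∈-map⁺ (_∷ v) (∈-map⁺ just (∈-allFin a)))

any-intro : {A : Set} (p : A → Bool) {xs : List A} {x : A} → x ∈ xs → T (p x) → T (any p xs)
any-intro p x∈xs px = any⁺ p (lose x∈xs px)

any-elim : {A : Set} (p : A → Bool) (xs : List A) → T (any p xs) → ∃ λ x → T (p x)
any-elim p xs h = satisfied (any⁻ p xs h)

module TeamSupport {N k : ℕ} (X : Team N k) (x : Fin k) where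

  isUpdate : Asg N k → Asg N k → Fin N → Bool
  isUpdate t s a = ⌊ t ≟A upd s x a ⌋

  [all/]-intro : ∀ s a → T (X s) → T ((X [all/ x ]ᵀ) (upd s x a))
  [all/]-intro s a s∈X =
    any-intro (λ s' → X s' ∧ any (isUpdate t s') (allFin N)) (allAsg-complete N k s)
      (Equivalence.from T-∧ (s∈X , any-intro (isUpdate t s) (∈-allFin a) (fromWitness refl)))
    where t = upd s x a

  [all/]-elim : ∀ t → T ((X [all/ x ]ᵀ) t) → ∃₂ λ s a → T (X s) × t ≡ upd s x a
  [all/]-elim t h =
    let s , hs    = any-elim (λ s' → X s' ∧ any (isUpdate t s') (allFin N)) (allAsg N k) h
        s∈X , ha  = Equivalence.to T-∧ hs
        a , t≟sa  = any-elim (isUpdate t s) (allFin N) ha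
    in s , a , s∈X , toWitness t≟sa

  [/]-intro : ∀ F s a → T (X s) → T (F s a) → T ((X [ F / x ]ᵀ) (upd s x a))
  [/]-intro F s a s∈X a∈Fs =
    any-intro (λ s' → X s' ∧ any (λ b → F s' b ∧ isUpdate t s' b) (allFin N)) (allAsg-complete N k s)
      (Equivalence.from T-∧ (s∈X , any-intro (λ b → F s b ∧ isUpdate t s b) (∈-allFin a)
        (Equivalence.from T-∧ (a∈Fs , fromWitness refl))))
    where t = upd s x a

  [/]-elim : ∀ F t → T ((X [ F / x ]ᵀ) t) → ∃₂ λ s a → T (X s) × T (F s a) × t ≡ upd s x a
  [/]-elim F t h =
    let s , hs      = any-elim (λ s' → X s' ∧ any (λ b → F s' b ∧ isUpdate t s' b) (allFin N))
                               (allAsg N k) h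
        s∈X , ha    = Equivalence.to T-∧ hs
        a , hsa     = any-elim (λ b → F s b ∧ isUpdate t s b) (allFin N) ha
        a∈Fs , t≟sa = Equivalence.to T-∧ hsa
    in s , a , s∈X , a∈Fs , toWitness t≟sa

-- This is
-- how a pointwise disjunction becomes a splitting of a team.
record Split (b : Bool) (A B : Set) : Set where
  field
    left right  : Bool
    left-sound  : T left → T b × A
    right-sound : T right → T b × B
    covers      : T b → T left ⊎ T right

split : {A B : Set} (b : Bool) → (T b → A ⊎ B) → Split b A B
split false _ = record
  { left = false ; right = false
  ; left-sound = λ () ; right-sound = λ () ; covers = λ () }
split true choice with choice tt
... | inj₁ a = record
  { left = true ; right = false
  ; left-sound = λ _ → tt , a ; right-sound = λ () ; covers = λ _ → inj₁ tt }
... | inj₂ b = record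
  { left = false ; right = true
  ; left-sound = λ () ; right-sound = λ _ → tt , b ; covers = λ _ → inj₂ tt }

witness : {C : Set} {P : C → Set} → DecidableEquality C →
          (b : Bool) → (T b → ∃ P) → C → Bool
witness _≟_ false _ _ = false
witness _≟_ true  w c = ⌊ c ≟ proj₁ (w tt) ⌋

witness-nonempty : {C : Set} {P : C → Set} (_≟_ : DecidableEquality C) (b : Bool)
                   (w : T b → ∃ P) → T b → ∃ λ c → T (witness _≟_ b w c)
witness-nonempty _≟_ true w _ = proj₁ (w tt) , fromWitness refl

witness-sound : {C : Set} {P : C → Set} (_≟_ : DecidableEquality C) (b : Bool)
                (w : T b → ∃ P) (c : C) → T (witness _≟_ b w c) → P c
witness-sound _≟_ true w c h with toWitness h
... | refl = proj₂ (w tt)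

module TeamFlat {τ : Vocabulary} {N k : ℕ} (𝔅 : Structure τ N) where
  open TeamSupport
  open Split

  sound : (X : Team N k) (φ : Formula τ k) →
          TSat 𝔅 X φ → ∀ s → T (X s) → Sat (srel 𝔅) s φ
  sound X (eq x y)   h = h
  sound X (neq x y)  h = h
  sound X (rl R xs)  h = h
  sound X (nrl R xs) h = h
  sound X (φ ∧ᶠ ψ) (hφ , hψ) s s∈X = sound X φ hφ s s∈X , sound X ψ hψ s s∈X
  sound X (φ ∨ᶠ ψ) (Y , Z , _ , _ , X⊆Y∪Z , hY , hZ) s s∈X with X⊆Y∪Z s s∈X
  ... | inj₁ s∈Y = inj₁ (sound Y φ hY s s∈Y)
  ... | inj₂ s∈Z = inj₂ (sound Z ψ hZ s s∈Z)
  sound X (allᶠ x φ) h s s∈X a =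
    sound (X [all/ x ]ᵀ) φ h (upd s x a) ([all/]-intro X x s a s∈X)
  sound X (exᶠ x φ) (F , F-nonempty , h) s s∈X =
    let a , a∈Fs = F-nonempty s s∈X
    in a , sound (X [ F / x ]ᵀ) φ h (upd s x a) ([/]-intro X x F s a s∈X a∈Fs)

  complete : (X : Team N k) (φ : Formula τ k) →
             (∀ s → T (X s) → Sat (srel 𝔅) s φ) → TSat 𝔅 X φ
  complete X (eq x y)   h = h
  complete X (neq x y)  h = h
  complete X (rl R xs)  h = h
  complete X (nrl R xs) h = h
  complete X (φ ∧ᶠ ψ) h =
    complete X φ (λ s s∈X → proj₁ (h s s∈X)) , complete X ψ (λ s s∈X → proj₂ (h s s∈X))
  complete X (φ ∨ᶠ ψ) h =
    Y , Z , (λ s → proj₁ ∘ left-sound (sides s)) , (λ s → proj₁ ∘ right-sound (sides s))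
      , (λ s → covers (sides s))
      , complete Y φ (λ s → proj₂ ∘ left-sound (sides s))
      , complete Z ψ (λ s → proj₂ ∘ right-sound (sides s))
    where
    sides : ∀ s → Split (X s) (Sat (srel 𝔅) s φ) (Sat (srel 𝔅) s ψ)
    sides s = split (X s) (h s)
    Y Z : Team N k
    Y s = left (sides s)
    Z s = right (sides s)
  complete X (allᶠ x φ) h = complete (X [all/ x ]ᵀ) φ λ t t∈X[A/x] →
    let s , a , s∈X , t≡sa = [all/]-elim X x t t∈X[A/x]
    in subst (λ t → Sat (srel 𝔅) t φ) (sym t≡sa) (h s s∈X a)
  complete X (exᶠ x φ) h =
    F , (λ s → witness-nonempty Fin._≟_ (X s) (h s))
      , complete (X [ F / x ]ᵀ) φ λ t t∈X[F/x] →
          let s , a , _ , a∈Fs , t≡sa = [/]-elim X x F t t∈X[F/x]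
          in subst (λ t → Sat (srel 𝔅) t φ) (sym t≡sa) (witness-sound Fin._≟_ (X s) (h s) a a∈Fs)
    where
    F : Asg N k → Fin N → Bool
    F s = witness Fin._≟_ (X s) (h s)

  flat : (X : Team N k) (φ : Formula τ k) →
         TSat 𝔅 X φ ⇔ (∀ s → T (X s) → Sat (srel 𝔅) s φ)
  flat X φ = mk⇔ (sound X φ) (complete X φ)

+-positive : ∀ m n → 1 ≤ m + n → 1 ≤ m ⊎ 1 ≤ n
+-positive zero    n h = inj₂ h
+-positive (suc m) n _ = inj₁ (s≤s z≤n)

*-positive : ∀ m n → 1 ≤ m * n → 1 ≤ m × 1 ≤ n
*-positive zero    n       ()
*-positive (suc m) (suc n) _ = s≤s z≤n , s≤s z≤n
*-positive (suc m) zero    h = contradiction (subst (1 ≤_) (*-zeroʳ (suc m)) h) λ ()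

⨄-intro : {I C : Set} (is : List I) (f : I → MSet C) (t : C) →
          Any (λ i → 1 ≤ f i t) is → 1 ≤ ⨄ is f t
⨄-intro (i ∷ is) f t (here h)  = ≤-trans h (m≤m+n _ _)
⨄-intro (i ∷ is) f t (there h) = ≤-trans (⨄-intro is f t h) (m≤n+m _ _)

⨄-elim : {I C : Set} (is : List I) (f : I → MSet C) (t : C) →
         1 ≤ ⨄ is f t → Any (λ i → 1 ≤ f i t) is
⨄-elim (i ∷ is) f t h with +-positive (f i t) (⨄ is f t) h
... | inj₁ h₁ = here h₁
... | inj₂ h₂ = there (⨄-elim is f t h₂)

single-intro : {C : Set} (_≟_ : DecidableEquality C) (t : C) (k : ℕ) →
               1 ≤ k → 1 ≤ single _≟_ t k t
single-intro _≟_ t k h with t ≟ t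
... | yes _   = h
... | no t≢t = contradiction refl t≢t

single-elim : {C : Set} (_≟_ : DecidableEquality C) (t : C) (k : ℕ) (u : C) →
              1 ≤ single _≟_ t k u → u ≡ t × 1 ≤ k
single-elim _≟_ t k u h with u ≟ t
... | yes u≡t = u≡t , h

single-≤ : {C : Set} (_≟_ : DecidableEquality C) (t : C) (k : ℕ) (u : C) →
           single _≟_ t k u ≤ k
single-≤ _≟_ t k u with u ≟ t
... | yes _ = ≤-refl
... | no _  = z≤n

pointwise-⊆ᴹ : {C : Set} {M M' : MSet C} → (∀ t → M t ≤ M' t) → M ⊆ᴹ M'
pointwise-⊆ᴹ M≤M' (t , i) (1≤i , i≤Mt) = 1≤i , ≤-trans i≤Mt (M≤M' t)

∈ᶜ⇒index : {C : Set} (M : MSet C) (s : C) (i : ℕ) → (s , i) ∈ᶜ M → i ∈ applyUpTo suc (M s)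
∈ᶜ⇒index M s (suc j) (_ , j<Ms) = ∈-applyUpTo⁺ suc j<Ms

module MultiteamSupport {N k : ℕ} (M : MTeam N k) (x : Fin k) where

  extend : MSet (Fin N) → Asg N k → Fin N → MTeam N k
  extend A s a = single _≟A_ (upd s x a) (M s * A a)

  extendᶠ : (Asg N k → ℕ → MSet (Fin N)) → Asg N k → ℕ → Fin N → MTeam N k
  extendᶠ F s i b = single _≟A_ (upd s x b) (F s i b)

  copyᶠ : (Asg N k → ℕ → MSet (Fin N)) → Asg N k → ℕ → MTeam N k
  copyᶠ F s i = ⨄ (allFin N) (extendᶠ F s i)

  copiesᶠ : (Asg N k → ℕ → MSet (Fin N)) → Asg N k → MTeam N k
  copiesᶠ F s = ⨄ (applyUpTo suc (M s)) (copyᶠ F s)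

  [/]-intro : ∀ A s a → 1 ≤ M s → 1 ≤ A a → 1 ≤ (M [ A / x ]ᴹ) (upd s x a)
  [/]-intro A s a s∈M a∈A =
    ⨄-intro (allAsg N k) (λ s' → ⨄ (allFin N) (extend A s')) t (lose (allAsg-complete N k s)
      (⨄-intro (allFin N) (extend A s) t (lose (∈-allFin a)
        (single-intro _≟A_ t (M s * A a) (*-mono-≤ s∈M a∈A)))))
    where t = upd s x a

  [/]-elim : ∀ A t → 1 ≤ (M [ A / x ]ᴹ) t → ∃₂ λ s a → 1 ≤ M s × 1 ≤ A a × t ≡ upd s x a
  [/]-elim A t h =
    let s , _ , hs = find (⨄-elim (allAsg N k) (λ s' → ⨄ (allFin N) (extend A s')) t h)
        a , _ , ha = find (⨄-elim (allFin N) (extend A s) t hs)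
        t≡sa , pos = single-elim _≟A_ (upd s x a) (M s * A a) t ha
        s∈M , a∈A  = *-positive (M s) (A a) pos
    in s , a , s∈M , a∈A , t≡sa

  [/]ᶠ-intro : ∀ F s i b → (s , i) ∈ᶜ M → 1 ≤ F s i b → 1 ≤ (M [ F / x ]ᶠ) (upd s x b)
  [/]ᶠ-intro F s i b si∈M b∈Fsi =
    ⨄-intro (allAsg N k) (copiesᶠ F) t (lose (allAsg-complete N k s)
      (⨄-intro (applyUpTo suc (M s)) (copyᶠ F s) t
        (lose (∈ᶜ⇒index M s i si∈M)
          (⨄-intro (allFin N) (extendᶠ F s i) t (lose (∈-allFin b)
            (single-intro _≟A_ t (F s i b) b∈Fsi))))))
    where t = upd s x b

  [/]ᶠ-elim : ∀ F t → 1 ≤ (M [ F / x ]ᶠ) t →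
              ∃ λ s → ∃₂ λ i b → 1 ≤ F s i b × t ≡ upd s x b
  [/]ᶠ-elim F t h =
    let s , _  , hs = find (⨄-elim (allAsg N k) (copiesᶠ F) t h)
        i , _  , hi = find (⨄-elim (applyUpTo suc (M s)) (copyᶠ F s) t hs)
        b , _  , hb = find (⨄-elim (allFin N) (extendᶠ F s i) t hi)
        t≡sb , b∈Fsi = single-elim _≟A_ (upd s x b) (F s i b) t hb
    in s , i , b , b∈Fsi , t≡sb

record MSplit (n : ℕ) (A B : Set) : Set where
  field
    left right  : ℕ
    left-≤      : left ≤ n
    right-≤     : right ≤ n
    covers      : n ≤ left + right
    left-sound  : 1 ≤ left → A
    right-sound : 1 ≤ right → B

msplit : {A B : Set} (n : ℕ) → (1 ≤ n → A ⊎ B) → MSplit n A B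
msplit zero _ = record
  { left = 0 ; right = 0 ; left-≤ = z≤n ; right-≤ = z≤n ; covers = z≤n
  ; left-sound = λ () ; right-sound = λ () }
msplit (suc n) choice with choice (s≤s z≤n)
... | inj₁ a = record
  { left = suc n ; right = 0 ; left-≤ = ≤-refl ; right-≤ = z≤n ; covers = m≤m+n (suc n) 0
  ; left-sound = λ _ → a ; right-sound = λ () }
... | inj₂ b = record
  { left = 0 ; right = suc n ; left-≤ = z≤n ; right-≤ = ≤-refl ; covers = ≤-refl
  ; left-sound = λ () ; right-sound = λ _ → b }

mwitness : {C : Set} {P : C → Set} → DecidableEquality C →
           (n : ℕ) → (1 ≤ n → ∃ P) → MSet C
mwitness _≟_ zero    _ = ∅ᴹ
mwitness _≟_ (suc n) w = single _≟_ (proj₁ (w (s≤s z≤n))) 1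

mwitness-nonempty : {C : Set} {P : C → Set} (_≟_ : DecidableEquality C) (n : ℕ)
                    (w : 1 ≤ n → ∃ P) → 1 ≤ n → ∃ λ c → 1 ≤ mwitness _≟_ n w c
mwitness-nonempty _≟_ (suc n) w _ =
  let c = proj₁ (w (s≤s z≤n)) in c , single-intro _≟_ c 1 ≤-refl

mwitness-≤1 : {C : Set} {P : C → Set} (_≟_ : DecidableEquality C) (n : ℕ)
              (w : 1 ≤ n → ∃ P) (c : C) → mwitness _≟_ n w c ≤ 1
mwitness-≤1 _≟_ zero    w c = z≤n
mwitness-≤1 _≟_ (suc n) w c = single-≤ _≟_ _ 1 c

mwitness-sound : {C : Set} {P : C → Set} (_≟_ : DecidableEquality C) (n : ℕ)
                 (w : 1 ≤ n → ∃ P) (c : C) → 1 ≤ mwitness _≟_ n w c → P c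
mwitness-sound _≟_ (suc n) w c h with single-elim _≟_ (proj₁ (w (s≤s z≤n))) 1 c h
... | refl , _ = proj₂ (w (s≤s z≤n))

module MultiteamFlat {τ : Vocabulary} {N k : ℕ} (𝔄 : MultiStructure τ N)
                     (full : ∀ a → 1 ≤ mult 𝔄 a) where
  open MultiteamSupport
  open MSplit

  sound : (M : MTeam N k) (φ : Formula τ k) →
          MSat 𝔄 M φ → ∀ s → 1 ≤ M s → Sat (rel 𝔄) s φ
  sound M (eq x y)   h = h
  sound M (neq x y)  h = h
  sound M (rl R xs)  h = h
  sound M (nrl R xs) h = h
  sound M (φ ∧ᶠ ψ) (hφ , hψ) s s∈M = sound M φ hφ s s∈M , sound M ψ hψ s s∈M
  sound M (φ ∨ᶠ ψ) (Y , Z , _ , _ , M⊆Y⊎Z , hY , hZ) s s∈M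
    with +-positive (Y s) (Z s) (proj₂ (M⊆Y⊎Z (s , 1) (≤-refl , s∈M)))
  ... | inj₁ s∈Y = inj₁ (sound Y φ hY s s∈Y)
  ... | inj₂ s∈Z = inj₂ (sound Z ψ hZ s s∈Z)
  sound M (allᶠ x φ) h s s∈M a =
    sound (M [ mult 𝔄 / x ]ᴹ) φ h (upd s x a) ([/]-intro M x (mult 𝔄) s a s∈M (full a))
  sound M (exᶠ x φ) (F , F-nonempty , h) s s∈M =
    let _ , b , b∈Fs1 = F-nonempty s 1 (≤-refl , s∈M)
    in b , sound (M [ F / x ]ᶠ) φ h (upd s x b) ([/]ᶠ-intro M x F s 1 b (≤-refl , s∈M) b∈Fs1)

  complete : (M : MTeam N k) (φ : Formula τ k) →
             (∀ s → 1 ≤ M s → Sat (rel 𝔄) s φ) → MSat 𝔄 M φ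
  complete M (eq x y)   h = h
  complete M (neq x y)  h = h
  complete M (rl R xs)  h = h
  complete M (nrl R xs) h = h
  complete M (φ ∧ᶠ ψ) h =
    complete M φ (λ s s∈M → proj₁ (h s s∈M)) , complete M ψ (λ s s∈M → proj₂ (h s s∈M))
  complete M (φ ∨ᶠ ψ) h =
    Y , Z , pointwise-⊆ᴹ (λ s → left-≤ (sides s)) , pointwise-⊆ᴹ (λ s → right-≤ (sides s))
      , pointwise-⊆ᴹ (λ s → covers (sides s))
      , complete Y φ (λ s → left-sound (sides s))
      , complete Z ψ (λ s → right-sound (sides s))
    where
    sides : ∀ s → MSplit (M s) (Sat (rel 𝔄) s φ) (Sat (rel 𝔄) s ψ)
    sides s = msplit (M s) (h s)
    Y Z : MTeam N k
    Y s = left (sides s)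
    Z s = right (sides s)
  complete M (allᶠ x φ) h = complete (M [ mult 𝔄 / x ]ᴹ) φ λ t t∈M[A/x] →
    let s , a , s∈M , _ , t≡sa = [/]-elim M x (mult 𝔄) t t∈M[A/x]
    in subst (λ t → Sat (rel 𝔄) t φ) (sym t≡sa) (h s s∈M a)
  complete M (exᶠ x φ) h =
    F , (λ s i si∈M → F-⊆ s i , mwitness-nonempty Fin._≟_ (M s) (h s) (≤-trans (proj₁ si∈M) (proj₂ si∈M)))
      , complete (M [ F / x ]ᶠ) φ λ t t∈M[F/x] →
          let s , i , b , b∈Fsi , t≡sb = [/]ᶠ-elim M x F t t∈M[F/x]
          in subst (λ t → Sat (rel 𝔄) t φ) (sym t≡sb) (mwitness-sound Fin._≟_ (M s) (h s) b b∈Fsi)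
    where
    F : Asg N k → ℕ → MSet (Fin N)
    F s _ = mwitness Fin._≟_ (M s) (h s)
    F-⊆ : ∀ s i → F s i ⊆ᴹ mult 𝔄
    F-⊆ s i = pointwise-⊆ᴹ λ b → ≤-trans (mwitness-≤1 Fin._≟_ (M s) (h s) b) (full b)

  flat : (M : MTeam N k) (φ : Formula τ k) →
         MSat 𝔄 M φ ⇔ (∀ s → 1 ≤ M s → Sat (rel 𝔄) s φ)
  flat M φ = mk⇔ (sound M φ) (complete M φ)

same-support : {N k : ℕ} (X : Team N k) (m : MTeam N k) (P : Asg N k → Set) →
               (∀ s → (T (X s) → m s ≡ 1) × (1 ≤ m s → T (X s))) →
               (∀ s → 1 ≤ m s → P s) ⇔ (∀ s → T (X s) → P s)
same-support X m P m≈X = mk⇔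
  (λ h s s∈X → h s (subst (1 ≤_) (sym (proj₁ (m≈X s) s∈X)) ≤-refl))
  (λ h s s∈m → h s (proj₂ (m≈X s) s∈m))

proposition2 : (τ : Vocabulary) (N k : ℕ) (𝔄 : MultiStructure τ N)
    (X : Team N k) (m : MTeam N k)
    → CommonDomain X
    → (∀ a → mult 𝔄 a ≡ 1)
    → (∀ s → (T (X s) → m s ≡ 1) × (1 ≤ m s → T (X s)))
    → (φ : Formula τ k)
    → MSat 𝔄 m φ ⇔ TSat (underlying 𝔄) X φ
proposition2 τ N k 𝔄 X m _ mult≡1 m≈X φ =
  ⇔.trans (MultiteamFlat.flat 𝔄 full m φ)
  (⇔.trans (same-support X m (λ s → Sat (rel 𝔄) s φ) m≈X)
           (⇔.sym (TeamFlat.flat (underlying 𝔄) X φ)))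
  where
  full : ∀ a → 1 ≤ mult 𝔄 a
  full a = subst (1 ≤_) (sym (mult≡1 a)) ≤-refl
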